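{- Let $G$ be an $r$-colored graph that is vertex transitive, and suppose that $Aut(G) = A\wr B$ (up to permutation isomorphism) for some permutation groups $(A,V)$ and $(B,W)$. Then there exist $r$-colored graphs $H_1$ and $H_2$ such that $Aut(H_1)=A$, $Aut(H_2)=B$, and $G = H_2\circ H_1$ (up to isomorphism).
   Context: An $r$-colored graph is a pair $(V,E)$ where $E$ is a function from the set $P_2(V)$ of unordered pairs of distinct vertices to a set of $r$ colors; an automorphism is a permutation $\sigma$ of $V$ with $E\{v,w\}=E\{v\sigma,w\sigma\}$ for all $v\ne w$, and $Aut(G)$ is regarded as a permutation group on the vertex set. Permutations act on the right. Permutation groups are considered up to permutation isomorphism and always act on sets with more than one element. For permutation groups $(A,V)$ and $(B,W)$, the (imprimitive) wreath product $A\wr B$ is the permutation group on $V\times W$ consisting of all permutations $\gamma$ for which there are $\alpha_w\in A$ ($w\in W$) and $\beta\in B$ with $(v,w)\gamma=(v\alpha_w,w\beta)$ for all $(v,w)$. For colored graphs $G_2=(W,E_2)$ and $G_1=(V,E_1)$, the composition $G_2\circ G_1$ is the colored graph on $W\times V$ in which the edge $\{(w_1,v_1),(w_2,v_2)\}$ has color $c$ if either $w_1\neq w_2$ and $E_2\{w_1,w_2\}=c$, or $w_1=w_2$ and $E_1\{v_1,v_2\}=c$. -}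

module Defs where

open import Data.Nat using (ℕ; _<_)
open import Data.Fin using (Fin; _≟_)
open import Data.Product using (_×_; _,_; Σ; ∃; proj₁; proj₂)
open import Function.Bundles using (_↔_; Inverse)
open import Relation.Binary.PropositionalEquality using (_≡_; _≢_; refl; sym; cong)
open import Relation.Nullary using (yes; no; ¬_)
open import Level using (Level; suc; _⊔_) renaming (zero to 0ℓ)

-- permutations of a type; they act on the right: v σ = σ ⟪ v ⟫
Perm : Set → Set
Perm V = V ↔ V

_⟪_⟫ : {V : Set} → Perm V → V → V
σ ⟪ v ⟫ = Inverse.to σ v

PermSet : Set → Set₁
PermSet V = Perm V → Set

record IsPermGroup {V : Set} (P : PermSet V) : Set where
  field
    ext   : ∀ σ τ → (∀ v → σ ⟪ v ⟫ ≡ τ ⟪ v ⟫) → P σ → P τ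
    hasId : ∃ λ ι → P ι × (∀ v → ι ⟪ v ⟫ ≡ v)
    comp  : ∀ σ τ → P σ → P τ → ∃ λ ρ → P ρ × (∀ v → ρ ⟪ v ⟫ ≡ τ ⟪ σ ⟪ v ⟫ ⟫)
    inv   : ∀ σ → P σ → ∃ λ ρ → P ρ × (∀ v → ρ ⟪ σ ⟪ v ⟫ ⟫ ≡ v)

_≐_ : {V : Set} → PermSet V → PermSet V → Set
P ≐ Q = ∀ σ → (P σ → Q σ) × (Q σ → P σ)

PermIso : {V V' : Set} → PermSet V → PermSet V' → Set
PermIso {V} {V'} P Q = Σ (V ↔ V') λ φ →
    (∀ σ → P σ → ∃ λ τ → Q τ × (∀ v → Inverse.to φ (σ ⟪ v ⟫) ≡ τ ⟪ Inverse.to φ v ⟫))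
  × (∀ τ → Q τ → ∃ λ σ → P σ × (∀ v → Inverse.to φ (σ ⟪ v ⟫) ≡ τ ⟪ Inverse.to φ v ⟫))

-- r-colored graph on vertex set V: colour function on pairs, symmetric on
-- pairs of distinct vertices (values on the diagonal are irrelevant and
-- ignored by every notion below) -- i.e. a function on unordered pairs
record ColGraph (r : ℕ) (V : Set) : Set where
  field
    edge : V → V → Fin r
    symm : ∀ x y → x ≢ y → edge x y ≡ edge y x
open ColGraph public

Aut : {r : ℕ} {V : Set} → ColGraph r V → PermSet V
Aut G σ = ∀ v w → v ≢ w → edge G v w ≡ edge G (σ ⟪ v ⟫) (σ ⟪ w ⟫)

VertexTransitive : {r : ℕ} {V : Set} → ColGraph r V → Set
VertexTransitive {V = V} G = ∀ (v w : V) → ∃ λ σ → Aut G σ × (σ ⟪ v ⟫ ≡ w)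

Wreath : {a b : ℕ} → PermSet (Fin a) → PermSet (Fin b) → PermSet (Fin a × Fin b)
Wreath {a} {b} A B γ =
  Σ (Fin b → Perm (Fin a)) λ α → (∀ w → A (α w)) ×
  (∃ λ β → B β × (∀ v w → γ ⟪ (v , w) ⟫ ≡ (α w ⟪ v ⟫ , β ⟪ w ⟫)))

private
  compEdge : {r m k : ℕ} → ColGraph r (Fin m) → ColGraph r (Fin k) →
             Fin m × Fin k → Fin m × Fin k → Fin r
  compEdge G₂ G₁ (w₁ , v₁) (w₂ , v₂) with w₁ ≟ w₂
  ... | yes _ = edge G₁ v₁ v₂
  ... | no  _ = edge G₂ w₁ w₂

  compSym : {r m k : ℕ} (G₂ : ColGraph r (Fin m)) (G₁ : ColGraph r (Fin k)) →
            ∀ x y → x ≢ y → compEdge G₂ G₁ x y ≡ compEdge G₂ G₁ y x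
  compSym G₂ G₁ (w₁ , v₁) (w₂ , v₂) ne with w₁ ≟ w₂ | w₂ ≟ w₁
  ... | yes refl | yes _ = symm G₁ v₁ v₂ (λ { refl → ne refl })
  ... | yes p | no q = Data.Empty.⊥-elim (q (sym p))
    where import Data.Empty
  ... | no p | yes q = Data.Empty.⊥-elim (p (sym q))
    where import Data.Empty
  ... | no p | no _ = symm G₂ w₁ w₂ p

_∘ᴳ_ : {r m k : ℕ} → ColGraph r (Fin m) → ColGraph r (Fin k) → ColGraph r (Fin m × Fin k)
G₂ ∘ᴳ G₁ = record { edge = compEdge G₂ G₁ ; symm = compSym G₂ G₁ }

GraphIso : {r : ℕ} {V V' : Set} → ColGraph r V → ColGraph r V' → Set
GraphIso {V = V} {V'} G H = Σ (V ↔ V') λ ψ →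
  ∀ x y → x ≢ y → edge G x y ≡ edge H (Inverse.to ψ x) (Inverse.to ψ y)

-- Transport G along the given permutation isomorphism to a graph E on the
-- set Fin a × Fin b on which Aut E is literally A ≀ B.  Since A ≀ B is
-- transitive, A moves any vertex of one block while fixing the other blocks,
-- and B permutes the blocks; hence the colour of an edge between two blocks
-- depends only on the blocks, and the colouring inside a block is the same
-- for every block.  So E is the composition H₂ ∘ H₁ of the graph H₁ induced on
-- one block and the quotient graph H₂ on the blocks.  Automorphisms of H₁ and
-- H₂ then lift to automorphisms of E, i.e. to elements of A ≀ B, which places
-- them in A and B respectively.
module Submission where

open import Defs
open import Data.Nat using (ℕ; _<_; s≤s)
open import Data.Fin using (Fin; _≟_; zero)
open import Data.Product using (_×_; ∃; ∃₂; _,_; proj₁; proj₂; swap)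
open import Data.Product.Algebra using (×-comm)
open import Data.Product.Function.NonDependent.Propositional using (_×-↔_)
open import Data.Empty using (⊥-elim)
open import Function using (_∘_)
open import Function.Bundles using (_↔_; Inverse; Injection; mk↔ₛ′)
open import Function.Properties.Inverse using (↔⇒↣)
open import Function.Construct.Identity using (↔-id)
open import Function.Construct.Symmetry using (↔-sym)
open import Function.Construct.Composition using (_↔-∘_)
open import Relation.Binary.PropositionalEquality
open import Relation.Nullary using (yes; no)

open Inverse using (to; from; strictlyInverseˡ; strictlyInverseʳ)

private
  variable
    r a b : ℕ
    V V' V'' : Set

↔-preserves-≢ : (φ : V ↔ V') {x y : V} → x ≢ y → to φ x ≢ to φ y
↔-preserves-≢ φ x≢y = x≢y ∘ Injection.injective (↔⇒↣ φ)

IsTransitive : PermSet V → Set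
IsTransitive {V} P = ∀ (x y : V) → ∃ λ σ → P σ × σ ⟪ x ⟫ ≡ y

PointwiseClosed : PermSet V → Set
PointwiseClosed P = ∀ σ τ → (∀ v → σ ⟪ v ⟫ ≡ τ ⟪ v ⟫) → P σ → P τ

IsPermGroup-id : {P : PermSet V} → IsPermGroup P → P (↔-id V)
IsPermGroup-id {V} G with IsPermGroup.hasId G
... | ι , ι∈P , ι≗id = IsPermGroup.ext G ι (↔-id V) ι≗id ι∈P

PermIso-transitive : {P : PermSet V} {Q : PermSet V'} →
  IsTransitive P → PermIso P Q → IsTransitive Q
PermIso-transitive trP (φ , P⇒Q , _) x y with trP (from φ x) (from φ y)
... | σ , σ∈P , σx≡y with P⇒Q σ σ∈P
... | τ , τ∈Q , φσ≡τφ = τ , τ∈Q , (begin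
  τ ⟪ x ⟫                    ≡⟨ cong (τ ⟪_⟫) (strictlyInverseˡ φ x) ⟨
  τ ⟪ to φ (from φ x) ⟫      ≡⟨ φσ≡τφ (from φ x) ⟨
  to φ (σ ⟪ from φ x ⟫)      ≡⟨ cong (to φ) σx≡y ⟩
  to φ (from φ y)            ≡⟨ strictlyInverseˡ φ y ⟩
  y                          ∎)
  where open ≡-Reasoning

Aut-id : (H : ColGraph r V) → Aut H (↔-id V)
Aut-id H _ _ _ = refl

GraphIso-trans : {G : ColGraph r V} {H : ColGraph r V'} {K : ColGraph r V''} →
  GraphIso G H → GraphIso H K → GraphIso G K
GraphIso-trans (ψ , G≅H) (χ , H≅K) =
  χ ↔-∘ ψ , λ x y x≢y → trans (G≅H x y x≢y) (H≅K _ _ (↔-preserves-≢ ψ x≢y))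

Aut-reflect : {G : ColGraph r V} {H : ColGraph r V'} (σ : Perm V) (ρ : Perm V') →
  ((ψ , _) : GraphIso G H) → Aut H ρ →
  (∀ x → to ψ (σ ⟪ x ⟫) ≡ ρ ⟪ to ψ x ⟫) → Aut G σ
Aut-reflect {G = G} {H} σ ρ (ψ , G≅H) autρ ψσ≡ρψ x y x≢y = begin
  edge G x y                                ≡⟨ G≅H x y x≢y ⟩
  edge H (to ψ x) (to ψ y)                  ≡⟨ autρ _ _ (↔-preserves-≢ ψ x≢y) ⟩
  edge H (ρ ⟪ to ψ x ⟫) (ρ ⟪ to ψ y ⟫)      ≡⟨ cong₂ (edge H) (ψσ≡ρψ x) (ψσ≡ρψ y) ⟨
  edge H (to ψ (σ ⟪ x ⟫)) (to ψ (σ ⟪ y ⟫))  ≡⟨ G≅H _ _ (↔-preserves-≢ σ x≢y) ⟨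
  edge G (σ ⟪ x ⟫) (σ ⟪ y ⟫)                ∎
  where open ≡-Reasoning

Aut-∘ : {m k : ℕ} {H₂ : ColGraph r (Fin m)} {H₁ : ColGraph r (Fin k)}
  {τ : Perm (Fin m)} {σ : Perm (Fin k)} →
  Aut H₂ τ → Aut H₁ σ → Aut (H₂ ∘ᴳ H₁) (τ ×-↔ σ)
Aut-∘ {τ = τ} autτ autσ (w₁ , v₁) (w₂ , v₂) x≢y
  with w₁ ≟ w₂ | τ ⟪ w₁ ⟫ ≟ τ ⟪ w₂ ⟫
... | yes refl | yes _       = autσ v₁ v₂ (x≢y ∘ cong (w₁ ,_))
... | yes refl | no τw≢τw    = ⊥-elim (τw≢τw refl)
... | no w₁≢w₂ | yes τw₁≡τw₂ = ⊥-elim (↔-preserves-≢ τ w₁≢w₂ τw₁≡τw₂)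
... | no w₁≢w₂ | no _        = autτ w₁ w₂ w₁≢w₂

transport : V ↔ V' → ColGraph r V → ColGraph r V'
transport φ G = record
  { edge = λ x y → edge G (from φ x) (from φ y)
  ; symm = λ x y x≢y → symm G _ _ (↔-preserves-≢ (↔-sym φ) x≢y)
  }

transport-iso : (φ : V ↔ V') (G : ColGraph r V) → GraphIso G (transport φ G)
transport-iso φ G = φ , λ x y _ →
  sym (cong₂ (edge G) (strictlyInverseʳ φ x) (strictlyInverseʳ φ y))

Aut-transport : {G : ColGraph r V} {P : PermSet V'} →
  ((φ , _) : PermIso (Aut G) P) → PointwiseClosed P → Aut (transport φ G) ≐ P
Aut-transport {G = G} {P} (φ , Aut⇒P , P⇒Aut) closed γ = Aut⇒P′ , P⇒Aut′
  where
  open ≡-Reasoning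

  Aut⇒P′ : Aut (transport φ G) γ → P γ
  Aut⇒P′ autγ with Aut⇒P σ autσ
    where
    σ = ↔-sym φ ↔-∘ (γ ↔-∘ φ)
    autσ : Aut G σ
    autσ = Aut-reflect {G = G} {H = transport φ G} σ γ (transport-iso φ G) autγ
      (λ _ → strictlyInverseˡ φ _)
  ... | τ , τ∈P , φσ≡τφ = closed τ γ τ≗γ τ∈P
    where
    τ≗γ : ∀ x → τ ⟪ x ⟫ ≡ γ ⟪ x ⟫
    τ≗γ x = begin
      τ ⟪ x ⟫                                ≡⟨ cong (τ ⟪_⟫) (strictlyInverseˡ φ x) ⟨
      τ ⟪ to φ (from φ x) ⟫                  ≡⟨ φσ≡τφ (from φ x) ⟨
      to φ (from φ (γ ⟪ to φ (from φ x) ⟫))  ≡⟨ strictlyInverseˡ φ _ ⟩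
      γ ⟪ to φ (from φ x) ⟫                  ≡⟨ cong (γ ⟪_⟫) (strictlyInverseˡ φ x) ⟩
      γ ⟪ x ⟫                                ∎

  P⇒Aut′ : P γ → Aut (transport φ G) γ
  P⇒Aut′ γ∈P with P⇒Aut γ γ∈P
  ... | σ , autσ , φσ≡γφ =
    Aut-reflect {G = transport φ G} {H = G} γ σ (↔-sym φ , λ _ _ _ → refl) autσ
      from-γ≡σ-from
    where
    from-γ≡σ-from : ∀ x → from φ (γ ⟪ x ⟫) ≡ σ ⟪ from φ x ⟫
    from-γ≡σ-from x = begin
      from φ (γ ⟪ x ⟫)                  ≡⟨ cong (from φ ∘ (γ ⟪_⟫)) (strictlyInverseˡ φ x) ⟨
      from φ (γ ⟪ to φ (from φ x) ⟫)    ≡⟨ cong (from φ) (φσ≡γφ (from φ x)) ⟨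
      from φ (to φ (σ ⟪ from φ x ⟫))    ≡⟨ strictlyInverseʳ φ _ ⟩
      σ ⟪ from φ x ⟫                    ∎

module WreathProduct (A : PermSet (Fin a)) (B : PermSet (Fin b)) where

  Wreath-pointwiseClosed : PointwiseClosed (Wreath A B)
  Wreath-pointwiseClosed γ γ′ γ≗γ′ (α , α∈A , β , β∈B , γ≡) =
    α , α∈A , β , β∈B , λ v w → trans (sym (γ≗γ′ (v , w))) (γ≡ v w)

  Wreath-× : (σ : Perm (Fin a)) (τ : Perm (Fin b)) → A σ → B τ → Wreath A B (σ ×-↔ τ)
  Wreath-× _ _ σ∈A τ∈B = (λ _ → _) , (λ _ → σ∈A) , _ , τ∈B , λ _ _ → refl

  Wreath-×-left : ∀ σ τ → IsPermGroup A → Fin b → Wreath A B (σ ×-↔ τ) → A σ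
  Wreath-×-left σ _ GA w (α , α∈A , _ , _ , γ≡) =
    IsPermGroup.ext GA (α w) σ (λ v → sym (cong proj₁ (γ≡ v w))) (α∈A w)

  Wreath-×-right : ∀ σ τ → IsPermGroup B → Fin a → Wreath A B (σ ×-↔ τ) → B τ
  Wreath-×-right _ τ GB v (_ , _ , β , β∈B , γ≡) =
    IsPermGroup.ext GB β τ (λ w → sym (cong proj₂ (γ≡ v w))) β∈B

  Wreath-transitive-left : Fin b → IsTransitive (Wreath A B) → IsTransitive A
  Wreath-transitive-left w trW v v′ with trW (v , w) (v′ , w)
  ... | _ , (α , α∈A , _ , _ , γ≡) , γvw≡v′w =
    α w , α∈A w , cong proj₁ (trans (sym (γ≡ v w)) γvw≡v′w)

  Wreath-transitive-right : Fin a → IsTransitive (Wreath A B) → IsTransitive B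
  Wreath-transitive-right v trW w w′ with trW (v , w) (v , w′)
  ... | _ , (_ , _ , β , β∈B , γ≡) , γvw≡vw′ =
    β , β∈B , cong proj₂ (trans (sym (γ≡ v w)) γvw≡vw′)

fibrewise : (Fin b → Perm (Fin a)) → Perm (Fin a × Fin b)
fibrewise α = mk↔ₛ′ (λ (v , w) → α w ⟪ v ⟫ , w) (λ (v , w) → from (α w) v , w)
  (λ (v , w) → cong (_, w) (strictlyInverseˡ (α w) v))
  (λ (v , w) → cong (_, w) (strictlyInverseʳ (α w) v))

atBlock : Fin b → Perm (Fin a) → Fin b → Perm (Fin a)
atBlock w σ w′ with w′ ≟ w
... | yes _ = σ
... | no  _ = ↔-id _

atBlock-here : ∀ (w : Fin b) σ (v : Fin a) → atBlock w σ w ⟪ v ⟫ ≡ σ ⟪ v ⟫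
atBlock-here w σ v with w ≟ w
... | yes _  = refl
... | no w≢w = ⊥-elim (w≢w refl)

atBlock-elsewhere : ∀ {w w′ : Fin b} σ (v : Fin a) → w′ ≢ w → atBlock w σ w′ ⟪ v ⟫ ≡ v
atBlock-elsewhere {w = w} {w′} σ v w′≢w with w′ ≟ w
... | yes w′≡w = ⊥-elim (w′≢w w′≡w)
... | no  _    = refl

module WreathGraph
  (E : ColGraph r (Fin a × Fin b)) {A : PermSet (Fin a)} {B : PermSet (Fin b)}
  (GA : IsPermGroup A) (GB : IsPermGroup B)
  (trA : IsTransitive A) (trB : IsTransitive B)
  (AutE≐Wreath : Aut E ≐ Wreath A B)
  (v₀ : Fin a) (w₀ : Fin b)
  where

  open WreathProduct A B
  open ≡-Reasoning

  Aut⇒Wreath : ∀ γ → Aut E γ → Wreath A B γ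
  Aut⇒Wreath γ = proj₁ (AutE≐Wreath γ)

  Wreath⇒Aut : ∀ γ → Wreath A B γ → Aut E γ
  Wreath⇒Aut γ = proj₂ (AutE≐Wreath γ)

  Aut-× : ∀ σ τ → A σ → B τ → Aut E (σ ×-↔ τ)
  Aut-× σ τ σ∈A τ∈B = Wreath⇒Aut (σ ×-↔ τ) (Wreath-× σ τ σ∈A τ∈B)

  edge-moveˡ : ∀ {w₁ w₂} → w₁ ≢ w₂ → ∀ v₁ v₁′ v₂ →
    edge E (v₁ , w₁) (v₂ , w₂) ≡ edge E (v₁′ , w₁) (v₂ , w₂)
  edge-moveˡ {w₁} {w₂} w₁≢w₂ v₁ v₁′ v₂ with trA v₁ v₁′
  ... | σ , σ∈A , σv₁≡v₁′ = begin
    edge E (v₁ , w₁) (v₂ , w₂)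
      ≡⟨ Wreath⇒Aut (fibrewise (atBlock w₁ σ)) γ∈Wreath _ _ (w₁≢w₂ ∘ cong proj₂) ⟩
    edge E (atBlock w₁ σ w₁ ⟪ v₁ ⟫ , w₁) (atBlock w₁ σ w₂ ⟪ v₂ ⟫ , w₂)
      ≡⟨ cong₂ (λ x y → edge E (x , w₁) (y , w₂))
           (trans (atBlock-here w₁ σ v₁) σv₁≡v₁′)
           (atBlock-elsewhere σ v₂ (w₁≢w₂ ∘ sym)) ⟩
    edge E (v₁′ , w₁) (v₂ , w₂) ∎
    where
    atBlock∈A : ∀ w → A (atBlock w₁ σ w)
    atBlock∈A w with w ≟ w₁
    ... | yes _ = σ∈A
    ... | no  _ = IsPermGroup-id GA
    γ∈Wreath : Wreath A B (fibrewise (atBlock w₁ σ))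
    γ∈Wreath = atBlock w₁ σ , atBlock∈A , ↔-id _ , IsPermGroup-id GB , λ _ _ → refl

  edge-between-blocks : ∀ {w₁ w₂} → w₁ ≢ w₂ → ∀ v₁ v₂ →
    edge E (v₁ , w₁) (v₂ , w₂) ≡ edge E (v₀ , w₁) (v₀ , w₂)
  edge-between-blocks w₁≢w₂ v₁ v₂ = begin
    edge E (v₁ , _) (v₂ , _)  ≡⟨ edge-moveˡ w₁≢w₂ v₁ v₀ v₂ ⟩
    edge E (v₀ , _) (v₂ , _)  ≡⟨ symm E _ _ (w₁≢w₂ ∘ cong proj₂) ⟩
    edge E (v₂ , _) (v₀ , _)  ≡⟨ edge-moveˡ (w₁≢w₂ ∘ sym) v₂ v₀ v₀ ⟩
    edge E (v₀ , _) (v₀ , _)  ≡⟨ symm E _ _ (w₁≢w₂ ∘ sym ∘ cong proj₂) ⟩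
    edge E (v₀ , _) (v₀ , _)  ∎

  edge-within-block : ∀ w {v₁ v₂} → v₁ ≢ v₂ →
    edge E (v₁ , w) (v₂ , w) ≡ edge E (v₁ , w₀) (v₂ , w₀)
  edge-within-block w {v₁} {v₂} v₁≢v₂ with trB w w₀
  ... | τ , τ∈B , τw≡w₀ = begin
    edge E (v₁ , w) (v₂ , w)                  ≡⟨ Aut-× (↔-id _) τ (IsPermGroup-id GA) τ∈B
                                                   _ _ (v₁≢v₂ ∘ cong proj₁) ⟩
    edge E (v₁ , τ ⟪ w ⟫) (v₂ , τ ⟪ w ⟫)      ≡⟨ cong (λ x → edge E (v₁ , x) (v₂ , x)) τw≡w₀ ⟩
    edge E (v₁ , w₀) (v₂ , w₀)                ∎

  block : ColGraph r (Fin a)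
  block = record
    { edge = λ v₁ v₂ → edge E (v₁ , w₀) (v₂ , w₀)
    ; symm = λ _ _ v₁≢v₂ → symm E _ _ (v₁≢v₂ ∘ cong proj₁)
    }

  quotient : ColGraph r (Fin b)
  quotient = record
    { edge = λ w₁ w₂ → edge E (v₀ , w₁) (v₀ , w₂)
    ; symm = λ _ _ w₁≢w₂ → symm E _ _ (w₁≢w₂ ∘ cong proj₂)
    }

  decomposition : GraphIso E (quotient ∘ᴳ block)
  decomposition = ×-comm _ _ , edge≡
    where
    edge≡ : ∀ x y → x ≢ y → edge E x y ≡ edge (quotient ∘ᴳ block) (swap x) (swap y)
    edge≡ (v₁ , w₁) (v₂ , w₂) x≢y with w₁ ≟ w₂
    ... | yes refl = edge-within-block w₁ (x≢y ∘ cong (_, w₁))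
    ... | no w₁≢w₂ = edge-between-blocks w₁≢w₂ v₁ v₂

  Aut-lift : ∀ σ τ → Aut block σ → Aut quotient τ → Aut E (σ ×-↔ τ)
  Aut-lift σ τ autσ autτ =
    Aut-reflect {G = E} {H = quotient ∘ᴳ block} (σ ×-↔ τ) (τ ×-↔ σ) decomposition
      (Aut-∘ {H₂ = quotient} {H₁ = block} {τ} {σ} autτ autσ) (λ _ → refl)

  Aut-block : Aut block ≐ A
  Aut-block σ = Aut⇒A , A⇒Aut
    where
    Aut⇒A : Aut block σ → A σ
    Aut⇒A autσ = Wreath-×-left σ (↔-id _) GA w₀
      (Aut⇒Wreath (σ ×-↔ ↔-id _) (Aut-lift σ (↔-id _) autσ (Aut-id quotient)))
    A⇒Aut : A σ → Aut block σ
    A⇒Aut σ∈A _ _ v₁≢v₂ =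
      Aut-× σ (↔-id _) σ∈A (IsPermGroup-id GB) _ _ (v₁≢v₂ ∘ cong proj₁)

  Aut-quotient : Aut quotient ≐ B
  Aut-quotient τ = Aut⇒B , B⇒Aut
    where
    Aut⇒B : Aut quotient τ → B τ
    Aut⇒B autτ = Wreath-×-right (↔-id _) τ GB v₀
      (Aut⇒Wreath (↔-id _ ×-↔ τ) (Aut-lift (↔-id _) τ (Aut-id block) autτ))
    B⇒Aut : B τ → Aut quotient τ
    B⇒Aut τ∈B _ _ w₁≢w₂ =
      Aut-× (↔-id _) τ (IsPermGroup-id GA) τ∈B _ _ (w₁≢w₂ ∘ cong proj₂)

theorem2p2 : ∀ {r n a b : ℕ} (G : ColGraph r (Fin n))
    (A : PermSet (Fin a)) (B : PermSet (Fin b)) →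
    1 < a → 1 < b → IsPermGroup A → IsPermGroup B →
    VertexTransitive G →
    PermIso (Aut G) (Wreath A B) →
    ∃₂ λ (H₁ : ColGraph r (Fin a)) (H₂ : ColGraph r (Fin b)) →
    (Aut H₁ ≐ A) × (Aut H₂ ≐ B) × GraphIso G (H₂ ∘ᴳ H₁)
theorem2p2 G A B (s≤s _) (s≤s _) GA GB transitiveG G≅Wreath =
  block , quotient , Aut-block , Aut-quotient ,
  GraphIso-trans {G = G} {H = transport φ G} {K = quotient ∘ᴳ block}
    (transport-iso φ G) decomposition
  where
  φ = proj₁ G≅Wreath
  open WreathProduct A B
  trW = PermIso-transitive transitiveG G≅Wreath
  open WreathGraph (transport φ G) GA GB
    (Wreath-transitive-left zero trW) (Wreath-transitive-right zero trW)
    (Aut-transport {G = G} G≅Wreath Wreath-pointwiseClosed) zero zero
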